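{- Let $m$ be a positive integer, $p$ an odd prime, and $a\in\mathbb{Z}_p$ with $a\not\equiv0\pmod p$. Then $$\sum_{k=0}^{p-1}\binom ak^m\sum_{r=0}^{[\frac{m-1}2]}\binom m{2r+1}\Big(1-\frac 2ak\Big)^{2r+1}\equiv\sum_{k=0}^{p-1}(-1)^k\binom ak^m\sum_{r=0}^{[m/2]}\binom m{2r}\Big(1-\frac2ak\Big)^{2r}\equiv2^{m-1}\frac{(a-\langle a\rangle_p)^m}{a^m}\big(1+mpH_{\langle a\rangle_p}\big)\pmod{p^{m+2}}.$$
   Context: $\mathbb{Z}_p$ denotes the set of rational numbers whose denominator is not divisible by $p$; congruences are taken in $\mathbb{Z}_p$. For $a\in\mathbb{Z}_p$, $\langle a\rangle_p$ is the unique integer in $\{0,1,\dots,p-1\}$ with $a\equiv\langle a\rangle_p\pmod p$. The general binomial coefficient is $\binom a0=1$, $\binom ak=a(a-1)\cdots(a-k+1)/k!$ for $k\ge1$. $[x]$ is the greatest integer not exceeding $x$. $H_0=0$, $H_n=1+\frac12+\cdots+\frac1n$. -}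

module Defs where

open import Data.Nat as ℕ using (ℕ; zero; suc)
open import Data.Nat.Divisibility using (_∣_)
open import Data.Integer as ℤ using (ℤ; +_; ∣_∣)
open import Data.Rational using (ℚ; ↥_; ↧ₙ_; _/_; _+_; _-_; _*_; 0ℚ; 1ℚ)
open import Data.Product using (_×_)
open import Relation.Nullary using (¬_)

ℕ→ℚ : ℕ → ℚ
ℕ→ℚ n = + n / 1

pow : ℚ → ℕ → ℚ
pow x zero    = 1ℚ
pow x (suc n) = pow x n * x

sumTo : ℕ → (ℕ → ℚ) → ℚ
sumTo zero    f = 0ℚ
sumTo (suc n) f = sumTo n f + f n

binomQ : ℚ → ℕ → ℚ
binomQ a zero    = 1ℚ
binomQ a (suc k) = binomQ a k * ((a - ℕ→ℚ k) * (+ 1 / suc k))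

H : ℕ → ℚ
H n = sumTo n (λ i → + 1 / suc i)

-- x ∈ ℤ_p : the (reduced) denominator of x is not divisible by p
InZp : ℕ → ℚ → Set
InZp p x = ¬ (p ∣ ↧ₙ x)

-- x ≡ y (mod p^k) in ℤ_p : (x - y)/p^k ∈ ℤ_p.
-- Since ℚ is kept in lowest terms, this means p^k divides the numerator
-- of x - y and p does not divide its denominator.
CongQ : ℕ → ℕ → ℚ → ℚ → Set
CongQ p k x y = (p ℕ.^ k) ∣ ∣ ↥ (x - y) ∣ × ¬ (p ∣ ↧ₙ (x - y))

{-# OPTIONS --safe #-}
-- Put u = 2/a and g k = (k·C(a,k))ᵐ. Splitting the binomial expansions of (1 ± b)ᵐ into even
-- and odd parts, with b = 1 - u k, 1 + b = u(a - k), 1 - b = u k and (a - k)·C(a,k) = (k + 1)·C(a,k + 1),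
-- the k-th summands of the two sums become ½uᵐ(g(k+1) - g k) and ½uᵐ(-1)ᵏ(g(k+1) + g k). As g 0 = 0 and
-- p is odd, both sums telescope to ½uᵐ(p·C(a,p))ᵐ, so they are equal. For the second congruence write
-- a = r + d with d ∈ pℤₚ: then p·C(a,p) = d·P, where P = C(a,r)·∏_{r<j<p} (a - j)/j is a product of
-- factors 1 + d/j (j ≤ r) and 1 + (d - p)/j (r < j < p). Hence
-- P ≡ 1 + d·H_r + (d - p)(H_{p-1} - H_r) ≡ 1 + p·H_r (mod p²), because p ∣ H_{p-1}; so Pᵐ ≡ 1 + m·p·H_r,
-- and dᵐ contributes the remaining factor pᵐ.

module Submission where

open import Defs
open import Data.Nat as ℕ using (ℕ; zero; suc; _≤_; _<_; _∸_; s≤s; z≤n)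
import Data.Nat.Properties as ℕₚ
open import Data.Nat.Combinatorics using (_C_; nCk+nC[k+1]≡[n+1]C[k+1]; k>n⇒nCk≡0)
import Data.Nat.Coprimality as Coprime
open import Data.Nat.Divisibility using (_∣_; divides; 1∣_; _∣0; ∣-refl; ∣-trans; *-pres-∣; ∣⇒≤; m∣m*n; ∣m⇒∣m*n; ∣n⇒∣m*n; *-monoʳ-∣; *-cancelˡ-∣)
open import Data.Nat.Primality using (Prime; euclidsLemma; prime⇒nonTrivial; prime⇒irreducible)
open import Data.Nat.DivMod using (m≡m%n+[m/n]*n; m%n<n)
import Data.Integer as ℤ
import Data.Integer.Properties as ℤₚ
import Data.Integer.Divisibility.Signed as ℤ∣
open import Data.Rational as ℚ using (ℚ; NonZero; mkℚ; toℚᵘ; ↥_; ↧ₙ_; _+_; _-_; _*_; -_; 1/_; ½; 0ℚ; 1ℚ)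
import Data.Rational.Properties as ℚₚ
open import Data.Rational.Unnormalised as ℚᵘ using (ℚᵘ; mkℚᵘ; *≡*)
import Data.Rational.Unnormalised.Properties as ℚᵘₚ
open import Data.Integer using (∣_∣)
open import Data.Product using (Σ; _×_; _,_; proj₁; proj₂)
open import Data.Sum using (inj₁; inj₂; [_,_])
open import Relation.Nullary using (¬_; contradiction)
open import Relation.Nullary.Decidable using (dec⇒maybe)
open import Tactic.RingSolver using (solve-∀)
open import Data.Nat.Tactic.RingSolver using () renaming (solve-∀ to ℕ-solve-∀)
open import Tactic.RingSolver.Core.AlmostCommutativeRing using (AlmostCommutativeRing; fromCommutativeRing)
open import Algebra.Bundles using (CommutativeMonoid)
import Algebra.Properties.CommutativeSemigroup as CommSemigroupProperties
open import Function using (_∘_)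
open import Relation.Binary.PropositionalEquality hiding ([_])
open ≡-Reasoning

ℚ-ring : AlmostCommutativeRing _ _
ℚ-ring = fromCommutativeRing ℚₚ.+-*-commutativeRing (λ x → dec⇒maybe (0ℚ ℚ.≟ x))

open CommSemigroupProperties (CommutativeMonoid.commutativeSemigroup ℚₚ.+-0-commutativeMonoid)
  using () renaming (interchange to +-interchange)
open CommSemigroupProperties (CommutativeMonoid.commutativeSemigroup ℚₚ.*-1-commutativeMonoid)
  using () renaming (interchange to *-interchange)

-- Finite sums and products

prodTo : ℕ → (ℕ → ℚ) → ℚ
prodTo zero    f = 1ℚ
prodTo (suc n) f = prodTo n f * f n

sumTo-cong : ∀ n {f g : ℕ → ℚ} → (∀ i → i < n → f i ≡ g i) → sumTo n f ≡ sumTo n g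
sumTo-cong zero    eq = refl
sumTo-cong (suc n) eq = cong₂ _+_ (sumTo-cong n λ i i<n → eq i (ℕₚ.m<n⇒m<1+n i<n)) (eq n ℕₚ.≤-refl)

prodTo-cong : ∀ n {f g : ℕ → ℚ} → (∀ i → i < n → f i ≡ g i) → prodTo n f ≡ prodTo n g
prodTo-cong zero    eq = refl
prodTo-cong (suc n) eq = cong₂ _*_ (prodTo-cong n λ i i<n → eq i (ℕₚ.m<n⇒m<1+n i<n)) (eq n ℕₚ.≤-refl)

sumTo-+ : ∀ n (f g : ℕ → ℚ) → sumTo n (λ i → f i + g i) ≡ sumTo n f + sumTo n g
sumTo-+ zero    f g = refl
sumTo-+ (suc n) f g = trans (cong (_+ (f n + g n)) (sumTo-+ n f g)) (+-interchange (sumTo n f) (sumTo n g) (f n) (g n))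

prodTo-* : ∀ n (f g : ℕ → ℚ) → prodTo n (λ i → f i * g i) ≡ prodTo n f * prodTo n g
prodTo-* zero    f g = refl
prodTo-* (suc n) f g = trans (cong (_* (f n * g n)) (prodTo-* n f g)) (*-interchange (prodTo n f) (prodTo n g) (f n) (g n))

sumTo-*ˡ : ∀ n c (f : ℕ → ℚ) → sumTo n (λ i → c * f i) ≡ c * sumTo n f
sumTo-*ˡ zero    c f = sym (ℚₚ.*-zeroʳ c)
sumTo-*ˡ (suc n) c f = trans (cong (_+ (c * f n)) (sumTo-*ˡ n c f)) (sym (ℚₚ.*-distribˡ-+ c _ _))

sumTo-neg : ∀ n (f : ℕ → ℚ) → sumTo n (λ i → - f i) ≡ - sumTo n f
sumTo-neg zero    f = refl
sumTo-neg (suc n) f = trans (cong (_+ (- f n)) (sumTo-neg n f)) (sym (ℚₚ.neg-distrib-+ (sumTo n f) (f n)))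

sumTo-shift : ∀ n (f : ℕ → ℚ) → sumTo (suc n) f ≡ f 0 + sumTo n (λ i → f (suc i))
sumTo-shift zero    f = ℚₚ.+-comm 0ℚ (f 0)
sumTo-shift (suc n) f = trans (cong (_+ f (suc n)) (sumTo-shift n f)) (ℚₚ.+-assoc (f 0) _ _)

prodTo-shift : ∀ n (f : ℕ → ℚ) → prodTo (suc n) f ≡ f 0 * prodTo n (λ i → f (suc i))
prodTo-shift zero    f = ℚₚ.*-comm 1ℚ (f 0)
prodTo-shift (suc n) f = trans (cong (_* f (suc n)) (prodTo-shift n f)) (ℚₚ.*-assoc (f 0) _ _)

sumTo-split : ∀ m n (f : ℕ → ℚ) → sumTo (m ℕ.+ n) f ≡ sumTo m f + sumTo n (λ i → f (m ℕ.+ i))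
sumTo-split m zero    f = trans (cong (λ k → sumTo k f) (ℕₚ.+-identityʳ m)) (sym (ℚₚ.+-identityʳ _))
sumTo-split m (suc n) f = begin
  sumTo (m ℕ.+ suc n) f                                       ≡⟨ cong (λ k → sumTo k f) (ℕₚ.+-suc m n) ⟩
  sumTo (m ℕ.+ n) f + f (m ℕ.+ n)                             ≡⟨ cong (_+ f (m ℕ.+ n)) (sumTo-split m n f) ⟩
  sumTo m f + sumTo n (λ i → f (m ℕ.+ i)) + f (m ℕ.+ n)       ≡⟨ ℚₚ.+-assoc (sumTo m f) _ _ ⟩
  sumTo m f + sumTo (suc n) (λ i → f (m ℕ.+ i))               ∎

sumTo-vanishing-tail : ∀ {m n} (f : ℕ → ℚ) → m ≤ n → (∀ i → m ≤ i → f i ≡ 0ℚ) → sumTo n f ≡ sumTo m f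
sumTo-vanishing-tail {m} {n} f m≤n vanish = begin
  sumTo n f                                   ≡⟨ cong (λ k → sumTo k f) (sym (ℕₚ.m+[n∸m]≡n m≤n)) ⟩
  sumTo (m ℕ.+ (n ∸ m)) f                     ≡⟨ sumTo-split m (n ∸ m) f ⟩
  sumTo m f + sumTo (n ∸ m) (λ i → f (m ℕ.+ i)) ≡⟨ cong (sumTo m f +_) (sumTo-zero (n ∸ m) λ i _ → vanish (m ℕ.+ i) (ℕₚ.m≤m+n m i)) ⟩
  sumTo m f + 0ℚ                              ≡⟨ ℚₚ.+-identityʳ _ ⟩
  sumTo m f                                   ∎
  where
  sumTo-zero : ∀ k {g : ℕ → ℚ} → (∀ i → i < k → g i ≡ 0ℚ) → sumTo k g ≡ 0ℚ
  sumTo-zero zero    _ = refl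
  sumTo-zero (suc k) z = trans (cong₂ _+_ (sumTo-zero k λ i i<k → z i (ℕₚ.m<n⇒m<1+n i<k)) (z k ℕₚ.≤-refl)) (ℚₚ.+-identityʳ 0ℚ)

sumTo-pairs : ∀ k (f : ℕ → ℚ) → sumTo (2 ℕ.* k) f ≡ sumTo k (λ j → f (2 ℕ.* j) + f (2 ℕ.* j ℕ.+ 1))
sumTo-pairs zero    f = refl
sumTo-pairs (suc k) f = begin
  sumTo (2 ℕ.* suc k) f                               ≡⟨ cong (λ z → sumTo z f) (ℕₚ.*-suc 2 k) ⟩
  sumTo (2 ℕ.* k) f + f (2 ℕ.* k) + f (suc (2 ℕ.* k)) ≡⟨ cong (λ z → sumTo (2 ℕ.* k) f + f (2 ℕ.* k) + f z) (ℕₚ.+-comm 1 (2 ℕ.* k)) ⟩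
  sumTo (2 ℕ.* k) f + f (2 ℕ.* k) + f (2 ℕ.* k ℕ.+ 1) ≡⟨ ℚₚ.+-assoc (sumTo (2 ℕ.* k) f) _ _ ⟩
  sumTo (2 ℕ.* k) f + (f (2 ℕ.* k) + f (2 ℕ.* k ℕ.+ 1)) ≡⟨ cong (_+ (f (2 ℕ.* k) + f (2 ℕ.* k ℕ.+ 1))) (sumTo-pairs k f) ⟩
  sumTo (suc k) (λ j → f (2 ℕ.* j) + f (2 ℕ.* j ℕ.+ 1)) ∎

n∸i≡1+[n∸1+i] : ∀ {n i} → i < n → n ∸ i ≡ suc (n ∸ suc i)
n∸i≡1+[n∸1+i] i<n = ℕₚ.+-∸-assoc 1 i<n

sumTo-reverse : ∀ n (f : ℕ → ℚ) → sumTo n f ≡ sumTo n (λ i → f (n ∸ suc i))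
sumTo-reverse zero    f = refl
sumTo-reverse (suc n) f = begin
  sumTo (suc n) f                                   ≡⟨ sumTo-shift n f ⟩
  f 0 + sumTo n (λ i → f (suc i))                   ≡⟨ cong (f 0 +_) (sumTo-reverse n (λ i → f (suc i))) ⟩
  f 0 + sumTo n (λ i → f (suc (n ∸ suc i)))         ≡⟨ ℚₚ.+-comm (f 0) _ ⟩
  sumTo n (λ i → f (suc (n ∸ suc i))) + f 0         ≡⟨ cong₂ _+_ (sumTo-cong n λ i i<n → cong f (sym (n∸i≡1+[n∸1+i] i<n)))
                                                                 (cong f (sym (ℕₚ.n∸n≡0 n))) ⟩
  sumTo (suc n) (λ i → f (suc n ∸ suc i))           ∎

prodTo-reverse : ∀ n (f : ℕ → ℚ) → prodTo n f ≡ prodTo n (λ i → f (n ∸ suc i))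
prodTo-reverse zero    f = refl
prodTo-reverse (suc n) f = begin
  prodTo (suc n) f                                  ≡⟨ prodTo-shift n f ⟩
  f 0 * prodTo n (λ i → f (suc i))                  ≡⟨ cong (f 0 *_) (prodTo-reverse n (λ i → f (suc i))) ⟩
  f 0 * prodTo n (λ i → f (suc (n ∸ suc i)))        ≡⟨ ℚₚ.*-comm (f 0) _ ⟩
  prodTo n (λ i → f (suc (n ∸ suc i))) * f 0        ≡⟨ cong₂ _*_ (prodTo-cong n λ i i<n → cong f (sym (n∸i≡1+[n∸1+i] i<n)))
                                                                 (cong f (sym (ℕₚ.n∸n≡0 n))) ⟩
  prodTo (suc n) (λ i → f (suc n ∸ suc i))          ∎

sumTo-telescope : ∀ n (g : ℕ → ℚ) → sumTo n (λ k → g (suc k) - g k) ≡ g n - g 0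
sumTo-telescope zero    g = sym (ℚₚ.+-inverseʳ (g 0))
sumTo-telescope (suc n) g = trans (cong (_+ (g (suc n) - g n)) (sumTo-telescope n g)) (cancel (g n) (g (suc n)) (g 0))
  where
  cancel : ∀ x y z → (x - z) + (y - x) ≡ y - z
  cancel = solve-∀ ℚ-ring

sumTo-alternating-telescope : ∀ n (g : ℕ → ℚ) →
  sumTo n (λ k → pow (- 1ℚ) k * (g (suc k) + g k)) ≡ g 0 - pow (- 1ℚ) n * g n
sumTo-alternating-telescope zero    g = cancel₀ (g 0)
  where
  cancel₀ : ∀ x → 0ℚ ≡ x - 1ℚ * x
  cancel₀ = solve-∀ ℚ-ring
sumTo-alternating-telescope (suc n) g =
  trans (cong (_+ (pow (- 1ℚ) n * (g (suc n) + g n))) (sumTo-alternating-telescope n g))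
        (cancel (g n) (g 0) (g (suc n)) (pow (- 1ℚ) n))
  where
  cancel : ∀ x z y s → (z - s * x) + s * (y + x) ≡ z - (s * (- 1ℚ)) * y
  cancel = solve-∀ ℚ-ring

-- Rational arithmetic

1/[1+_] : ℕ → ℚ
1/[1+ k ] = ℤ.+ 1 ℚ./ suc k

ℕ→ℚ≡mkℚ : ∀ n → ℕ→ℚ n ≡ mkℚ (ℤ.+ n) 0 (Coprime.sym (Coprime.1-coprimeTo n))
ℕ→ℚ≡mkℚ n = ℚₚ.normalize-coprime (Coprime.sym (Coprime.1-coprimeTo n))

ℕ→ℚ-+ : ∀ m n → ℕ→ℚ (m ℕ.+ n) ≡ ℕ→ℚ m + ℕ→ℚ n
ℕ→ℚ-+ m n = ℚₚ.toℚᵘ-injective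
  (ℚᵘₚ.≃-trans (ℚᵘₚ.≃-reflexive (toℚᵘ-ℕ→ℚ (m ℕ.+ n)))
  (ℚᵘₚ.≃-trans (*≡* (cong (ℤ._* ℤ.+ 1) (sym (cong₂ ℤ._+_ (ℤₚ.*-identityʳ (ℤ.+ m)) (ℤₚ.*-identityʳ (ℤ.+ n))))))
  (ℚᵘₚ.≃-trans (ℚᵘₚ.≃-reflexive (sym (cong₂ ℚᵘ._+_ (toℚᵘ-ℕ→ℚ m) (toℚᵘ-ℕ→ℚ n))))
               (ℚᵘₚ.≃-sym (ℚₚ.toℚᵘ-homo-+ (ℕ→ℚ m) (ℕ→ℚ n))))))
  where
  toℚᵘ-ℕ→ℚ : ∀ n → toℚᵘ (ℕ→ℚ n) ≡ mkℚᵘ (ℤ.+ n) 0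
  toℚᵘ-ℕ→ℚ n = cong toℚᵘ (ℕ→ℚ≡mkℚ n)

ℕ→ℚ-suc : ∀ n → ℕ→ℚ (suc n) ≡ ℕ→ℚ n + 1ℚ
ℕ→ℚ-suc n = trans (cong ℕ→ℚ (ℕₚ.+-comm 1 n)) (ℕ→ℚ-+ n 1)

ℕ→ℚ-*-1/[1+] : ∀ k → ℕ→ℚ (suc k) * 1/[1+ k ] ≡ 1ℚ
ℕ→ℚ-*-1/[1+] k rewrite ℕ→ℚ≡mkℚ (suc k) | ℚₚ.normalize-coprime {1} {k} (Coprime.1-coprimeTo (suc k)) =
  ℚₚ.*-inverseʳ (mkℚ (ℤ.+ suc k) 0 (Coprime.sym (Coprime.1-coprimeTo (suc k))))

pow≡prodTo : ∀ x n → pow x n ≡ prodTo n (λ _ → x)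
pow≡prodTo x zero    = refl
pow≡prodTo x (suc n) = cong (_* x) (pow≡prodTo x n)

sumTo-const : ∀ n x → sumTo n (λ _ → x) ≡ ℕ→ℚ n * x
sumTo-const zero    x = sym (ℚₚ.*-zeroˡ x)
sumTo-const (suc n) x = begin
  sumTo n (λ _ → x) + x     ≡⟨ cong (_+ x) (sumTo-const n x) ⟩
  ℕ→ℚ n * x + x             ≡⟨ expand (ℕ→ℚ n) x ⟩
  (ℕ→ℚ n + 1ℚ) * x          ≡⟨ cong (_* x) (sym (ℕ→ℚ-suc n)) ⟩
  ℕ→ℚ (suc n) * x           ∎
  where
  expand : ∀ n x → n * x + x ≡ (n + 1ℚ) * x
  expand = solve-∀ ℚ-ring

pow-* : ∀ x y n → pow (x * y) n ≡ pow x n * pow y n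
pow-* x y zero    = refl
pow-* x y (suc n) = trans (cong (_* (x * y)) (pow-* x y n)) (*-interchange (pow x n) (pow y n) x y)

pow-0 : ∀ n → .{{ℕ.NonZero n}} → pow 0ℚ n ≡ 0ℚ
pow-0 (suc n) = ℚₚ.*-zeroʳ (pow 0ℚ n)

pow-neg-even : ∀ b j → pow (- b) (2 ℕ.* j) ≡ pow b (2 ℕ.* j)
pow-neg-even b zero    = refl
pow-neg-even b (suc j) = begin
  pow (- b) (2 ℕ.* suc j)             ≡⟨ cong (pow (- b)) (ℕₚ.*-suc 2 j) ⟩
  pow (- b) (2 ℕ.* j) * (- b) * (- b) ≡⟨ cong (λ z → z * (- b) * (- b)) (pow-neg-even b j) ⟩
  pow b (2 ℕ.* j) * (- b) * (- b)     ≡⟨ neg-square (pow b (2 ℕ.* j)) b ⟩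
  pow b (2 ℕ.* j) * b * b             ≡⟨ cong (pow b) (sym (ℕₚ.*-suc 2 j)) ⟩
  pow b (2 ℕ.* suc j)                 ∎
  where
  neg-square : ∀ x b → x * (- b) * (- b) ≡ x * b * b
  neg-square = solve-∀ ℚ-ring

pow-neg-odd : ∀ b j → pow (- b) (2 ℕ.* j ℕ.+ 1) ≡ - pow b (2 ℕ.* j ℕ.+ 1)
pow-neg-odd b j = begin
  pow (- b) (2 ℕ.* j ℕ.+ 1) ≡⟨ cong (pow (- b)) (ℕₚ.+-comm (2 ℕ.* j) 1) ⟩
  pow (- b) (2 ℕ.* j) * (- b) ≡⟨ cong (_* (- b)) (pow-neg-even b j) ⟩
  pow b (2 ℕ.* j) * (- b)   ≡⟨ sym (ℚₚ.neg-distribʳ-* (pow b (2 ℕ.* j)) b) ⟩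
  - (pow b (2 ℕ.* j) * b)   ≡⟨ cong (λ z → - pow b z) (ℕₚ.+-comm 1 (2 ℕ.* j)) ⟩
  - pow b (2 ℕ.* j ℕ.+ 1)   ∎

pow-1 : ∀ n → pow 1ℚ n ≡ 1ℚ
pow-1 zero    = refl
pow-1 (suc n) = cong (_* 1ℚ) (pow-1 n)

pow-neg-1-odd : ∀ q → pow (- 1ℚ) (2 ℕ.* q ℕ.+ 1) ≡ - 1ℚ
pow-neg-1-odd q = trans (pow-neg-odd 1ℚ q) (cong -_ (pow-1 (2 ℕ.* q ℕ.+ 1)))

-- Binomial expansions

binomial : ∀ m b → pow (1ℚ + b) m ≡ sumTo (suc m) (λ i → ℕ→ℚ (m C i) * pow b i)
binomial zero    b = refl
binomial (suc m) b = begin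
  pow (1ℚ + b) m * (1ℚ + b)                            ≡⟨ cong (_* (1ℚ + b)) (binomial m b) ⟩
  S * (1ℚ + b)                                         ≡⟨ distrib S b ⟩
  S + b * S                                            ≡⟨ cong (_+ b * S) (sym S≡1+tail) ⟩
  1ℚ + sumTo (suc m) (λ i → t (suc i)) + b * S         ≡⟨ ℚₚ.+-assoc 1ℚ (sumTo (suc m) (λ i → t (suc i))) (b * S) ⟩
  1ℚ + (sumTo (suc m) (λ i → t (suc i)) + b * S)       ≡⟨ cong (λ z → 1ℚ + (sumTo (suc m) (λ i → t (suc i)) + z)) (sym (sumTo-*ˡ (suc m) b t)) ⟩
  1ℚ + (sumTo (suc m) (λ i → t (suc i)) + sumTo (suc m) (λ i → b * t i))
                                                       ≡⟨ cong (1ℚ +_) (sym (sumTo-+ (suc m) (λ i → t (suc i)) (λ i → b * t i))) ⟩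
  1ℚ + sumTo (suc m) (λ i → t (suc i) + b * t i)       ≡⟨ cong (1ℚ +_) (sumTo-cong (suc m) λ i _ → pascal i) ⟩
  1ℚ + sumTo (suc m) (λ i → ℕ→ℚ (suc m C suc i) * pow b (suc i))
                                                       ≡⟨ sym (sumTo-shift (suc m) (λ i → ℕ→ℚ (suc m C i) * pow b i)) ⟩
  sumTo (suc (suc m)) (λ i → ℕ→ℚ (suc m C i) * pow b i) ∎
  where
  t : ℕ → ℚ
  t i = ℕ→ℚ (m C i) * pow b i
  S : ℚ
  S = sumTo (suc m) t
  distrib : ∀ S b → S * (1ℚ + b) ≡ S + b * S
  distrib = solve-∀ ℚ-ring
  S≡1+tail : 1ℚ + sumTo (suc m) (λ i → t (suc i)) ≡ S
  S≡1+tail = begin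
    1ℚ + sumTo (suc m) (λ i → t (suc i)) ≡⟨ sym (sumTo-shift (suc m) t) ⟩
    S + t (suc m)                        ≡⟨ cong (λ c → S + ℕ→ℚ c * pow b (suc m)) (k>n⇒nCk≡0 (ℕₚ.n<1+n m)) ⟩
    S + 0ℚ * pow b (suc m)               ≡⟨ cong (S +_) (ℚₚ.*-zeroˡ (pow b (suc m))) ⟩
    S + 0ℚ                               ≡⟨ ℚₚ.+-identityʳ S ⟩
    S                                    ∎
  pascal : ∀ i → t (suc i) + b * t i ≡ ℕ→ℚ (suc m C suc i) * pow b (suc i)
  pascal i = begin
    t (suc i) + b * t i                                         ≡⟨ rearrange (ℕ→ℚ (m C i)) (ℕ→ℚ (m C suc i)) (pow b i) b ⟩
    (ℕ→ℚ (m C i) + ℕ→ℚ (m C suc i)) * (pow b i * b)             ≡⟨ cong (_* pow b (suc i)) (sym (ℕ→ℚ-+ (m C i) (m C suc i))) ⟩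
    ℕ→ℚ (m C i ℕ.+ m C suc i) * pow b (suc i)                   ≡⟨ cong (λ c → ℕ→ℚ c * pow b (suc i)) (nCk+nC[k+1]≡[n+1]C[k+1] m i) ⟩
    ℕ→ℚ (suc m C suc i) * pow b (suc i)                         ∎
    where
    rearrange : ∀ c c′ x b → c′ * (x * b) + b * (c * x) ≡ (c + c′) * (x * b)
    rearrange = solve-∀ ℚ-ring

evenPart oddPart : ℕ → ℕ → ℚ → ℚ
evenPart m K b = sumTo K (λ j → ℕ→ℚ (m C (2 ℕ.* j)) * pow b (2 ℕ.* j))
oddPart  m K b = sumTo K (λ j → ℕ→ℚ (m C (2 ℕ.* j ℕ.+ 1)) * pow b (2 ℕ.* j ℕ.+ 1))

binomial-parity : ∀ {m} K b → m < 2 ℕ.* K → pow (1ℚ + b) m ≡ evenPart m K b + oddPart m K b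
binomial-parity {m} K b m<2K = begin
  pow (1ℚ + b) m                                                ≡⟨ binomial m b ⟩
  sumTo (suc m) t                                               ≡⟨ sym (sumTo-vanishing-tail t m<2K (λ i m<i → trans (cong (λ c → ℕ→ℚ c * pow b i) (k>n⇒nCk≡0 m<i)) (ℚₚ.*-zeroˡ (pow b i)))) ⟩
  sumTo (2 ℕ.* K) t                                             ≡⟨ sumTo-pairs K t ⟩
  sumTo K (λ j → t (2 ℕ.* j) + t (2 ℕ.* j ℕ.+ 1))               ≡⟨ sumTo-+ K (λ j → t (2 ℕ.* j)) (λ j → t (2 ℕ.* j ℕ.+ 1)) ⟩
  evenPart m K b + oddPart m K b                                ∎
  where
  t : ℕ → ℚ
  t i = ℕ→ℚ (m C i) * pow b i

evenPart-neg : ∀ m K b → evenPart m K (- b) ≡ evenPart m K b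
evenPart-neg m K b = sumTo-cong K λ j _ → cong (ℕ→ℚ (m C (2 ℕ.* j)) *_) (pow-neg-even b j)

oddPart-neg : ∀ m K b → oddPart m K (- b) ≡ - oddPart m K b
oddPart-neg m K b = trans
  (sumTo-cong K λ j _ → trans (cong (ℕ→ℚ (m C (2 ℕ.* j ℕ.+ 1)) *_) (pow-neg-odd b j)) (sym (ℚₚ.neg-distribʳ-* (ℕ→ℚ (m C (2 ℕ.* j ℕ.+ 1))) (pow b (2 ℕ.* j ℕ.+ 1)))))
  (sumTo-neg K (λ j → ℕ→ℚ (m C (2 ℕ.* j ℕ.+ 1)) * pow b (2 ℕ.* j ℕ.+ 1)))

binomial-parity-neg : ∀ {m} K b → m < 2 ℕ.* K → pow (1ℚ - b) m ≡ evenPart m K b - oddPart m K b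
binomial-parity-neg {m} K b m<2K =
  trans (binomial-parity K (- b) m<2K) (cong₂ _+_ (evenPart-neg m K b) (oddPart-neg m K b))

evenPart-closed : ∀ {m} K b → m < 2 ℕ.* K → evenPart m K b ≡ ½ * (pow (1ℚ + b) m + pow (1ℚ - b) m)
evenPart-closed {m} K b m<2K = sym (trans
  (cong₂ (λ x y → ½ * (x + y)) (binomial-parity K b m<2K) (binomial-parity-neg K b m<2K))
  (half-sum (evenPart m K b) (oddPart m K b)))
  where
  half-sum : ∀ E O → ½ * ((E + O) + (E - O)) ≡ E
  half-sum = solve-∀ ℚ-ring

oddPart-closed : ∀ {m} K b → m ≤ 2 ℕ.* K → oddPart m K b ≡ ½ * (pow (1ℚ + b) m - pow (1ℚ - b) m)
oddPart-closed {m} K b m≤2K = begin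
  oddPart m K b                                       ≡⟨ sym (ℚₚ.+-identityʳ (oddPart m K b)) ⟩
  oddPart m K b + 0ℚ                                  ≡⟨ cong (oddPart m K b +_) (sym top-vanishes) ⟩
  oddPart m (suc K) b                                 ≡⟨ sym (trans (cong₂ (λ x y → ½ * (x - y)) (binomial-parity (suc K) b m<2K′) (binomial-parity-neg (suc K) b m<2K′))
                                                               (half-difference (evenPart m (suc K) b) (oddPart m (suc K) b))) ⟩
  ½ * (pow (1ℚ + b) m - pow (1ℚ - b) m)               ∎
  where
  m<2K′ : m < 2 ℕ.* suc K
  m<2K′ = ℕₚ.≤-<-trans m≤2K (ℕₚ.*-monoʳ-< 2 (ℕₚ.n<1+n K))
  top-vanishes : ℕ→ℚ (m C (2 ℕ.* K ℕ.+ 1)) * pow b (2 ℕ.* K ℕ.+ 1) ≡ 0ℚ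
  top-vanishes = trans (cong (λ c → ℕ→ℚ c * pow b (2 ℕ.* K ℕ.+ 1)) (k>n⇒nCk≡0 (ℕₚ.≤-trans (s≤s m≤2K) (ℕₚ.≤-reflexive (ℕₚ.+-comm 1 (2 ℕ.* K))))))
                       (ℚₚ.*-zeroˡ (pow b (2 ℕ.* K ℕ.+ 1)))
  half-difference : ∀ E O → ½ * ((E + O) - (E - O)) ≡ O
  half-difference = solve-∀ ℚ-ring

binomQ-absorb : ∀ a k → binomQ a k * (a - ℕ→ℚ k) ≡ binomQ a (suc k) * ℕ→ℚ (suc k)
binomQ-absorb a k = sym (begin
  binomQ a k * ((a - ℕ→ℚ k) * 1/[1+ k ]) * ℕ→ℚ (suc k) ≡⟨ rearrange (binomQ a k) (a - ℕ→ℚ k) 1/[1+ k ] (ℕ→ℚ (suc k)) ⟩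
  binomQ a k * (a - ℕ→ℚ k) * (ℕ→ℚ (suc k) * 1/[1+ k ]) ≡⟨ cong (binomQ a k * (a - ℕ→ℚ k) *_) (ℕ→ℚ-*-1/[1+] k) ⟩
  binomQ a k * (a - ℕ→ℚ k) * 1ℚ                        ≡⟨ ℚₚ.*-identityʳ _ ⟩
  binomQ a k * (a - ℕ→ℚ k)                             ∎)
  where
  rearrange : ∀ β x w c → β * (x * w) * c ≡ β * x * (c * w)
  rearrange = solve-∀ ℚ-ring

binomQ≡prodTo : ∀ a k → binomQ a k ≡ prodTo k (λ j → (a - ℕ→ℚ j) * 1/[1+ j ])
binomQ≡prodTo a zero    = refl
binomQ≡prodTo a (suc k) = cong (_* ((a - ℕ→ℚ k) * 1/[1+ k ])) (binomQ≡prodTo a k)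

binomQ-*-index : ∀ a r t → binomQ a (suc (r ℕ.+ t)) * ℕ→ℚ (suc (r ℕ.+ t)) ≡
  (a - ℕ→ℚ r) * (binomQ a r * prodTo t (λ s → (a - ℕ→ℚ (suc (r ℕ.+ s))) * 1/[1+ r ℕ.+ s ]))
binomQ-*-index a r zero = begin
  binomQ a (suc (r ℕ.+ 0)) * ℕ→ℚ (suc (r ℕ.+ 0)) ≡⟨ cong (λ k → binomQ a (suc k) * ℕ→ℚ (suc k)) (ℕₚ.+-identityʳ r) ⟩
  binomQ a (suc r) * ℕ→ℚ (suc r)                 ≡⟨ sym (binomQ-absorb a r) ⟩
  binomQ a r * (a - ℕ→ℚ r)                       ≡⟨ swap (binomQ a r) (a - ℕ→ℚ r) ⟩
  (a - ℕ→ℚ r) * (binomQ a r * 1ℚ)                ∎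
  where
  swap : ∀ x y → x * y ≡ y * (x * 1ℚ)
  swap = solve-∀ ℚ-ring
binomQ-*-index a r (suc t) = begin
  binomQ a (suc (r ℕ.+ suc t)) * ℕ→ℚ (suc (r ℕ.+ suc t)) ≡⟨ cong (λ k → binomQ a (suc k) * ℕ→ℚ (suc k)) (ℕₚ.+-suc r t) ⟩
  binomQ a (suc K) * ℕ→ℚ (suc K)                        ≡⟨ sym (binomQ-absorb a K) ⟩
  binomQ a K * (a - ℕ→ℚ K)                              ≡⟨ sym (ℚₚ.*-identityʳ _) ⟩
  binomQ a K * (a - ℕ→ℚ K) * 1ℚ                         ≡⟨ cong (binomQ a K * (a - ℕ→ℚ K) *_) (sym (ℕ→ℚ-*-1/[1+] (r ℕ.+ t))) ⟩
  binomQ a K * (a - ℕ→ℚ K) * (ℕ→ℚ K * 1/[1+ r ℕ.+ t ])  ≡⟨ regroup (binomQ a K) (a - ℕ→ℚ K) (ℕ→ℚ K) 1/[1+ r ℕ.+ t ] ⟩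
  binomQ a K * ℕ→ℚ K * ((a - ℕ→ℚ K) * 1/[1+ r ℕ.+ t ])  ≡⟨ cong (_* ((a - ℕ→ℚ K) * 1/[1+ r ℕ.+ t ])) (binomQ-*-index a r t) ⟩
  (a - ℕ→ℚ r) * (binomQ a r * T) * ((a - ℕ→ℚ K) * 1/[1+ r ℕ.+ t ])
                                                        ≡⟨ reassoc (a - ℕ→ℚ r) (binomQ a r) T _ ⟩
  (a - ℕ→ℚ r) * (binomQ a r * (T * ((a - ℕ→ℚ K) * 1/[1+ r ℕ.+ t ]))) ∎
  where
  K : ℕ
  K = suc (r ℕ.+ t)
  T : ℚ
  T = prodTo t (λ s → (a - ℕ→ℚ (suc (r ℕ.+ s))) * 1/[1+ r ℕ.+ s ])
  regroup : ∀ β x c w → β * x * (c * w) ≡ β * c * (x * w)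
  regroup = solve-∀ ℚ-ring
  reassoc : ∀ d β T y → d * (β * T) * y ≡ d * (β * (T * y))
  reassoc = solve-∀ ℚ-ring

-ℕ→ℚ-split : ∀ c A {B C} → A ℕ.+ B ≡ C → c - ℕ→ℚ A ≡ (c - ℕ→ℚ C) + ℕ→ℚ B
-ℕ→ℚ-split c A {B} refl = trans (shift c (ℕ→ℚ A) (ℕ→ℚ B)) (cong (λ x → (c - x) + ℕ→ℚ B) (sym (ℕ→ℚ-+ A B)))
  where
  shift : ∀ c a b → c - a ≡ (c - (a + b)) + b
  shift = solve-∀ ℚ-ring

[x+1+k]*1/[1+k] : ∀ x k → (x + ℕ→ℚ (suc k)) * 1/[1+ k ] ≡ 1ℚ + x * 1/[1+ k ]
[x+1+k]*1/[1+k] x k = begin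
  (x + ℕ→ℚ (suc k)) * 1/[1+ k ]               ≡⟨ distrib x (ℕ→ℚ (suc k)) 1/[1+ k ] ⟩
  ℕ→ℚ (suc k) * 1/[1+ k ] + x * 1/[1+ k ]     ≡⟨ cong (_+ x * 1/[1+ k ]) (ℕ→ℚ-*-1/[1+] k) ⟩
  1ℚ + x * 1/[1+ k ]                          ∎
  where
  distrib : ∀ x c w → (x + c) * w ≡ c * w + x * w
  distrib = solve-∀ ℚ-ring

-- Reversing the numerators pairs c - (o + n - 1 - s) with the denominator o′ + 1 + s; their
-- difference c - (o + n + o′) does not depend on s.
prodTo-reflect : ∀ c o o′ n →
  prodTo n (λ s → (c - ℕ→ℚ (o ℕ.+ s)) * 1/[1+ o′ ℕ.+ s ]) ≡
  prodTo n (λ s → 1ℚ + (c - ℕ→ℚ (o ℕ.+ n ℕ.+ o′)) * 1/[1+ o′ ℕ.+ s ])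
prodTo-reflect c o o′ n = begin
  prodTo n (λ s → num s * den s)                   ≡⟨ prodTo-* n num den ⟩
  prodTo n num * prodTo n den                      ≡⟨ cong (_* prodTo n den) (prodTo-reverse n num) ⟩
  prodTo n (λ s → num (n ∸ suc s)) * prodTo n den  ≡⟨ sym (prodTo-* n (λ s → num (n ∸ suc s)) den) ⟩
  prodTo n (λ s → num (n ∸ suc s) * den s)         ≡⟨ prodTo-cong n reflected ⟩
  prodTo n (λ s → 1ℚ + e * den s)                  ∎
  where
  e : ℚ
  e = c - ℕ→ℚ (o ℕ.+ n ℕ.+ o′)
  num den : ℕ → ℚ
  num s = c - ℕ→ℚ (o ℕ.+ s)
  den s = 1/[1+ o′ ℕ.+ s ]
  complement : ∀ {s} → s < n → o ℕ.+ (n ∸ suc s) ℕ.+ suc (o′ ℕ.+ s) ≡ o ℕ.+ n ℕ.+ o′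
  complement {s} s<n = trans (regroup o (n ∸ suc s) o′ s) (cong (λ z → o ℕ.+ z ℕ.+ o′) (ℕₚ.m∸n+n≡m s<n))
    where
    regroup : ∀ o x o′ s → o ℕ.+ x ℕ.+ suc (o′ ℕ.+ s) ≡ o ℕ.+ (x ℕ.+ suc s) ℕ.+ o′
    regroup = ℕ-solve-∀
  reflected : ∀ s → s < n → num (n ∸ suc s) * den s ≡ 1ℚ + e * den s
  reflected s s<n = trans (cong (_* den s) (-ℕ→ℚ-split c (o ℕ.+ (n ∸ suc s)) (complement s<n))) ([x+1+k]*1/[1+k] e (o′ ℕ.+ s))

-- Evaluation of both sums

n<2*[1+n/2] : ∀ n → n < 2 ℕ.* suc (n ℕ./ 2)
n<2*[1+n/2] n = subst₂ _<_ (sym (m≡m%n+[m/n]*n n 2)) (twice (n ℕ./ 2)) (ℕₚ.+-monoˡ-< (n ℕ./ 2 ℕ.* 2) (m%n<n n 2))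
  where
  twice : ∀ q → 2 ℕ.+ q ℕ.* 2 ≡ 2 ℕ.* suc q
  twice = ℕ-solve-∀

prime⇒odd : ∀ {p} → Prime p → p ≢ 2 → Σ ℕ λ q → p ≡ 2 ℕ.* q ℕ.+ 1
prime⇒odd {p} p-prime p≢2 with p ℕ.% 2 | m≡m%n+[m/n]*n p 2 | m%n<n p 2
... | 0 | p≡ | _ with prime⇒irreducible p-prime (divides (p ℕ./ 2) p≡)
...   | inj₁ ()
...   | inj₂ 2≡p = contradiction (sym 2≡p) p≢2
prime⇒odd {p} p-prime p≢2 | 1 | p≡ | _ = p ℕ./ 2 , trans p≡ (swap (p ℕ./ 2))
  where
  swap : ∀ q → 1 ℕ.+ q ℕ.* 2 ≡ 2 ℕ.* q ℕ.+ 1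
  swap = ℕ-solve-∀
prime⇒odd _ _ | suc (suc _) | _ | s≤s (s≤s ())

module Telescoping (a : ℚ) .{{_ : ℚ.NonZero a}} (m : ℕ) .{{_ : ℕ.NonZero m}} where

  u : ℚ
  u = ℕ→ℚ 2 * 1/ a

  g : ℕ → ℚ
  g k = pow (binomQ a k * ℕ→ℚ k) m

  1+[1-uk] : ∀ k → 1ℚ + (1ℚ - u * ℕ→ℚ k) ≡ u * (a - ℕ→ℚ k)
  1+[1-uk] k = begin
    1ℚ + (1ℚ - u * ℕ→ℚ k)                           ≡⟨ expand (1/ a) a (ℕ→ℚ k) ⟩
    u * (a - ℕ→ℚ k) + (ℕ→ℚ 2 - ℕ→ℚ 2 * (1/ a * a))  ≡⟨ cong (λ z → u * (a - ℕ→ℚ k) + (ℕ→ℚ 2 - ℕ→ℚ 2 * z)) (ℚₚ.*-inverseˡ a) ⟩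
    u * (a - ℕ→ℚ k) + 0ℚ                            ≡⟨ ℚₚ.+-identityʳ (u * (a - ℕ→ℚ k)) ⟩
    u * (a - ℕ→ℚ k)                                 ∎
    where
    expand : ∀ i a k → 1ℚ + (1ℚ - ℕ→ℚ 2 * i * k) ≡ ℕ→ℚ 2 * i * (a - k) + (ℕ→ℚ 2 - ℕ→ℚ 2 * (i * a))
    expand = solve-∀ ℚ-ring

  1-[1-uk] : ∀ k → 1ℚ - (1ℚ - u * ℕ→ℚ k) ≡ u * ℕ→ℚ k
  1-[1-uk] k = cancel (u * ℕ→ℚ k)
    where
    cancel : ∀ x → 1ℚ - (1ℚ - x) ≡ x
    cancel = solve-∀ ℚ-ring

  β^m*[u*x]^m : ∀ k x → pow (binomQ a k) m * pow (u * x) m ≡ pow u m * pow (binomQ a k * x) m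
  β^m*[u*x]^m k x = begin
    pow β m * pow (u * x) m         ≡⟨ cong (pow β m *_) (pow-* u x m) ⟩
    pow β m * (pow u m * pow x m)   ≡⟨ swap (pow β m) (pow u m) (pow x m) ⟩
    pow u m * (pow β m * pow x m)   ≡⟨ cong (pow u m *_) (sym (pow-* β x m)) ⟩
    pow u m * pow (β * x) m         ∎
    where
    β : ℚ
    β = binomQ a k
    swap : ∀ x y z → x * (y * z) ≡ y * (x * z)
    swap = solve-∀ ℚ-ring

  oddSummand : ∀ K k → m ≤ 2 ℕ.* K →
    pow (binomQ a k) m * oddPart m K (1ℚ - u * ℕ→ℚ k) ≡ ½ * pow u m * (g (suc k) - g k)
  oddSummand K k m≤2K = begin
    pow β m * oddPart m K b                                            ≡⟨ cong (pow β m *_) (oddPart-closed K b m≤2K) ⟩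
    pow β m * (½ * (pow (1ℚ + b) m - pow (1ℚ - b) m))                  ≡⟨ cong₂ (λ x y → pow β m * (½ * (pow x m - pow y m))) (1+[1-uk] k) (1-[1-uk] k) ⟩
    pow β m * (½ * (pow (u * (a - ℕ→ℚ k)) m - pow (u * ℕ→ℚ k) m))      ≡⟨ distrib (pow β m) (pow (u * (a - ℕ→ℚ k)) m) (pow (u * ℕ→ℚ k) m) ⟩
    ½ * (pow β m * pow (u * (a - ℕ→ℚ k)) m - pow β m * pow (u * ℕ→ℚ k) m)
      ≡⟨ cong₂ (λ x y → ½ * (x - y)) (β^m*[u*x]^m k (a - ℕ→ℚ k)) (β^m*[u*x]^m k (ℕ→ℚ k)) ⟩
    ½ * (pow u m * pow (β * (a - ℕ→ℚ k)) m - pow u m * g k)            ≡⟨ cong (λ z → ½ * (pow u m * pow z m - pow u m * g k)) (binomQ-absorb a k) ⟩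
    ½ * (pow u m * g (suc k) - pow u m * g k)                          ≡⟨ factor (pow u m) (g (suc k)) (g k) ⟩
    ½ * pow u m * (g (suc k) - g k)                                    ∎
    where
    β b : ℚ
    β = binomQ a k
    b = 1ℚ - u * ℕ→ℚ k
    distrib : ∀ c x y → c * (½ * (x - y)) ≡ ½ * (c * x - c * y)
    distrib = solve-∀ ℚ-ring
    factor : ∀ c x y → ½ * (c * x - c * y) ≡ ½ * c * (x - y)
    factor = solve-∀ ℚ-ring

  evenSummand : ∀ K k → m < 2 ℕ.* K →
    pow (- 1ℚ) k * pow (binomQ a k) m * evenPart m K (1ℚ - u * ℕ→ℚ k) ≡ ½ * pow u m * (pow (- 1ℚ) k * (g (suc k) + g k))
  evenSummand K k m<2K = begin
    s * pow β m * evenPart m K b                                       ≡⟨ cong (s * pow β m *_) (evenPart-closed K b m<2K) ⟩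
    s * pow β m * (½ * (pow (1ℚ + b) m + pow (1ℚ - b) m))              ≡⟨ cong₂ (λ x y → s * pow β m * (½ * (pow x m + pow y m))) (1+[1-uk] k) (1-[1-uk] k) ⟩
    s * pow β m * (½ * (pow (u * (a - ℕ→ℚ k)) m + pow (u * ℕ→ℚ k) m))  ≡⟨ distrib s (pow β m) (pow (u * (a - ℕ→ℚ k)) m) (pow (u * ℕ→ℚ k) m) ⟩
    ½ * (s * (pow β m * pow (u * (a - ℕ→ℚ k)) m + pow β m * pow (u * ℕ→ℚ k) m))
      ≡⟨ cong₂ (λ x y → ½ * (s * (x + y))) (β^m*[u*x]^m k (a - ℕ→ℚ k)) (β^m*[u*x]^m k (ℕ→ℚ k)) ⟩
    ½ * (s * (pow u m * pow (β * (a - ℕ→ℚ k)) m + pow u m * g k))      ≡⟨ cong (λ z → ½ * (s * (pow u m * pow z m + pow u m * g k))) (binomQ-absorb a k) ⟩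
    ½ * (s * (pow u m * g (suc k) + pow u m * g k))                    ≡⟨ factor s (pow u m) (g (suc k)) (g k) ⟩
    ½ * pow u m * (s * (g (suc k) + g k))                              ∎
    where
    s β b : ℚ
    s = pow (- 1ℚ) k
    β = binomQ a k
    b = 1ℚ - u * ℕ→ℚ k
    distrib : ∀ s c x y → s * c * (½ * (x + y)) ≡ ½ * (s * (c * x + c * y))
    distrib = solve-∀ ℚ-ring
    factor : ∀ s c x y → ½ * (s * (c * x + c * y)) ≡ ½ * c * (s * (x + y))
    factor = solve-∀ ℚ-ring

  g-0 : g 0 ≡ 0ℚ
  g-0 = pow-0 m

  oddSum : ∀ n K → m ≤ 2 ℕ.* K →
    sumTo n (λ k → pow (binomQ a k) m * oddPart m K (1ℚ - u * ℕ→ℚ k)) ≡ ½ * pow u m * g n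
  oddSum n K m≤2K = begin
    sumTo n (λ k → pow (binomQ a k) m * oddPart m K (1ℚ - u * ℕ→ℚ k)) ≡⟨ sumTo-cong n (λ k _ → oddSummand K k m≤2K) ⟩
    sumTo n (λ k → ½ * pow u m * (g (suc k) - g k)) ≡⟨ sumTo-*ˡ n (½ * pow u m) (λ k → g (suc k) - g k) ⟩
    ½ * pow u m * sumTo n (λ k → g (suc k) - g k)   ≡⟨ cong (½ * pow u m *_) (sumTo-telescope n g) ⟩
    ½ * pow u m * (g n - g 0)                       ≡⟨ cong (λ z → ½ * pow u m * (g n - z)) g-0 ⟩
    ½ * pow u m * (g n - 0ℚ)                        ≡⟨ cong (½ * pow u m *_) (ℚₚ.+-identityʳ (g n)) ⟩
    ½ * pow u m * g n                               ∎

  evenSum : ∀ {n} q → n ≡ 2 ℕ.* q ℕ.+ 1 → ∀ K → m < 2 ℕ.* K →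
    sumTo n (λ k → pow (- 1ℚ) k * pow (binomQ a k) m * evenPart m K (1ℚ - u * ℕ→ℚ k)) ≡ ½ * pow u m * g n
  evenSum {n} q refl K m<2K = begin
    sumTo n (λ k → pow (- 1ℚ) k * pow (binomQ a k) m * evenPart m K (1ℚ - u * ℕ→ℚ k))
                                                        ≡⟨ sumTo-cong n (λ k _ → evenSummand K k m<2K) ⟩
    sumTo n (λ k → ½ * pow u m * (pow (- 1ℚ) k * (g (suc k) + g k)))
                                                        ≡⟨ sumTo-*ˡ n (½ * pow u m) (λ k → pow (- 1ℚ) k * (g (suc k) + g k)) ⟩
    ½ * pow u m * sumTo n (λ k → pow (- 1ℚ) k * (g (suc k) + g k))
                                                        ≡⟨ cong (½ * pow u m *_) (sumTo-alternating-telescope n g) ⟩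
    ½ * pow u m * (g 0 - pow (- 1ℚ) n * g n)            ≡⟨ cong₂ (λ x s → ½ * pow u m * (x - s * g n)) g-0 (pow-neg-1-odd q) ⟩
    ½ * pow u m * (0ℚ - (- 1ℚ) * g n)                   ≡⟨ cong (½ * pow u m *_) (cancel (g n)) ⟩
    ½ * pow u m * g n                                   ∎
    where
    cancel : ∀ x → 0ℚ - (- 1ℚ) * x ≡ x
    cancel = solve-∀ ℚ-ring

  oddSideSum evenSideSum : ℕ → ℚ
  oddSideSum  n = sumTo n (λ k → pow (binomQ a k) m * oddPart m (suc ((m ∸ 1) ℕ./ 2)) (1ℚ - u * ℕ→ℚ k))
  evenSideSum n = sumTo n (λ k → pow (- 1ℚ) k * pow (binomQ a k) m * evenPart m (suc (m ℕ./ 2)) (1ℚ - u * ℕ→ℚ k))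

  oddSideSum-closed : ∀ n → oddSideSum n ≡ ½ * pow u m * g n
  oddSideSum-closed n = oddSum n (suc ((m ∸ 1) ℕ./ 2)) (subst (_≤ 2 ℕ.* suc ((m ∸ 1) ℕ./ 2)) (ℕₚ.suc-pred m) (n<2*[1+n/2] (m ∸ 1)))

  evenSideSum-closed : ∀ {n} q → n ≡ 2 ℕ.* q ℕ.+ 1 → evenSideSum n ≡ ½ * pow u m * g n
  evenSideSum-closed q n≡2q+1 = evenSum q n≡2q+1 (suc (m ℕ./ 2)) (n<2*[1+n/2] m)

-- p-adic divisibility of rationals

module PAdic {p : ℕ} (p-prime : Prime p) where

  instance
    p-nonTrivial : ℕ.NonTrivial p
    p-nonTrivial = prime⇒nonTrivial p-prime
    p-nonZero : ℕ.NonZero p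
    p-nonZero = ℕ.nonTrivial⇒nonZero p

  p∤1 : ¬ p ∣ 1
  p∤1 p∣1 = ℕₚ.<⇒≱ (ℕ.nonTrivial⇒n>1 p) (∣⇒≤ p∣1)

  p∤-positive : ∀ {j} → 0 < j → j < p → ¬ p ∣ j
  p∤-positive {suc j} _ j<p p∣j = ℕₚ.<⇒≱ j<p (∣⇒≤ p∣j)

  p∤* : ∀ {m n} → ¬ p ∣ m → ¬ p ∣ n → ¬ p ∣ m ℕ.* n
  p∤* {m} {n} p∤m p∤n p∣mn = [ p∤m , p∤n ] (euclidsLemma m n p-prime p∣mn)

  p^k∣m*n⇒p^k∣m : ∀ k {m n} → ¬ p ∣ n → p ℕ.^ k ∣ m ℕ.* n → p ℕ.^ k ∣ m
  p^k∣m*n⇒p^k∣m zero    _   _ = 1∣ _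
  p^k∣m*n⇒p^k∣m (suc k) {m} {n} p∤n p^k+1∣mn with euclidsLemma m n p-prime (∣-trans (m∣m*n (p ℕ.^ k)) p^k+1∣mn)
  ... | inj₂ p∣n = contradiction p∣n p∤n
  ... | inj₁ (divides q refl) =
    subst (p ℕ.* p ℕ.^ k ∣_) (ℕₚ.*-comm p q)
      (*-monoʳ-∣ p (p^k∣m*n⇒p^k∣m k p∤n (*-cancelˡ-∣ p (subst (p ℕ.* p ℕ.^ k ∣_) (regroup q p n) p^k+1∣mn))))
    where
    regroup : ∀ q p n → q ℕ.* p ℕ.* n ≡ p ℕ.* (q ℕ.* n)
    regroup = ℕ-solve-∀

  infix 4 p^_∣_ p^_∣ᵘ_

  -- p^ k ∣ x means x ∈ pᵏℤₚ, so CongQ p k x y says p^ k ∣ x - y; as a record, x can be inferred.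
  record p^_∣_ (k : ℕ) (x : ℚ) : Set where
    constructor num∣∧den∤
    field
      num : p ℕ.^ k ∣ ∣ ↥ x ∣
      den : ¬ p ∣ ↧ₙ x

  record p^_∣ᵘ_ (k : ℕ) (x : ℚᵘ) : Set where
    constructor num∣∧den∤
    field
      num : p ℕ.^ k ∣ ∣ ℚᵘ.↥ x ∣
      den : ¬ p ∣ ℚᵘ.↧ₙ x

  fromCongQ : ∀ {k x y} → CongQ p k x y → p^ k ∣ x - y
  fromCongQ (num , den) = num∣∧den∤ num den

  toCongQ : ∀ {k x y} → p^ k ∣ x - y → CongQ p k x y
  toCongQ (num∣∧den∤ num den) = num , den

  toℚᵘ-∣ : ∀ {k x} → p^ k ∣ x → p^ k ∣ᵘ toℚᵘ x
  toℚᵘ-∣ {x = mkℚ _ _ _} (num∣∧den∤ num den) = num∣∧den∤ num den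

  -- Membership of pᵏℤₚ can be read off any unnormalised representative.
  ≃ᵘ-∣ : ∀ {k x q} → toℚᵘ x ℚᵘ.≃ q → p^ k ∣ᵘ q → p^ k ∣ x
  ≃ᵘ-∣ {k} {mkℚ n d c} {mkℚᵘ n′ d′} (*≡* eq) (num∣∧den∤ num den) =
    num∣∧den∤ (p^k∣m*n⇒p^k∣m k den (subst (p ℕ.^ k ∣_) (sym cross) (∣m⇒∣m*n (suc d) num))) p∤d
    where
    cross : ∣ n ∣ ℕ.* suc d′ ≡ ∣ n′ ∣ ℕ.* suc d
    cross = trans (sym (ℤₚ.abs-* n (ℤ.+ suc d′))) (trans (cong ∣_∣ eq) (ℤₚ.abs-* n′ (ℤ.+ suc d)))
    p∤d : ¬ p ∣ suc d
    p∤d p∣d with euclidsLemma ∣ n ∣ (suc d′) p-prime (subst (p ∣_) (sym cross) (∣n⇒∣m*n ∣ n′ ∣ p∣d))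
    ... | inj₂ p∣d′ = den p∣d′
    ... | inj₁ p∣n  = ℕ.nonTrivial⇒≢1 (Coprime.recompute c (p∣n , p∣d))

  private
    ∣ᵘ-+ : ∀ {k x y} → p^ k ∣ᵘ x → p^ k ∣ᵘ y → p^ k ∣ᵘ x ℚᵘ.+ y
    ∣ᵘ-+ {k} {mkℚᵘ n d} {mkℚᵘ m e} (num∣∧den∤ n∣ d∤) (num∣∧den∤ m∣ e∤) =
      num∣∧den∤
        (ℤ∣.∣⇒∣ᵤ (ℤ∣.∣m∣n⇒∣m+n (ℤ∣.∣m⇒∣m*n (ℤ.+ suc e) (ℤ∣.∣ᵤ⇒∣ {ℤ.+ (p ℕ.^ k)} {n} n∣)) (ℤ∣.∣m⇒∣m*n (ℤ.+ suc d) (ℤ∣.∣ᵤ⇒∣ {ℤ.+ (p ℕ.^ k)} {m} m∣))))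
        (p∤* d∤ e∤)

    ∣ᵘ-* : ∀ {k l x y} → p^ k ∣ᵘ x → p^ l ∣ᵘ y → p^ (k ℕ.+ l) ∣ᵘ x ℚᵘ.* y
    ∣ᵘ-* {k} {l} {mkℚᵘ n d} {mkℚᵘ m e} (num∣∧den∤ n∣ d∤) (num∣∧den∤ m∣ e∤) =
      num∣∧den∤
        (subst₂ _∣_ (sym (ℕₚ.^-distribˡ-+-* p k l)) (sym (ℤₚ.abs-* n m)) (*-pres-∣ n∣ m∣))
        (p∤* d∤ e∤)

    ∣ᵘ-neg : ∀ {k x} → p^ k ∣ᵘ x → p^ k ∣ᵘ ℚᵘ.- x
    ∣ᵘ-neg {x = mkℚᵘ n d} (num∣∧den∤ n∣ d∤) =
      num∣∧den∤ (subst (_ ∣_) (sym (ℤₚ.∣-i∣≡∣i∣ n)) n∣) d∤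

  ∣-+ : ∀ {k x y} → p^ k ∣ x → p^ k ∣ y → p^ k ∣ x + y
  ∣-+ {x = x} {y} x∣ y∣ = ≃ᵘ-∣ (ℚₚ.toℚᵘ-homo-+ x y) (∣ᵘ-+ (toℚᵘ-∣ x∣) (toℚᵘ-∣ y∣))

  ∣-* : ∀ {k l x y} → p^ k ∣ x → p^ l ∣ y → p^ (k ℕ.+ l) ∣ x * y
  ∣-* {x = x} {y} x∣ y∣ = ≃ᵘ-∣ (ℚₚ.toℚᵘ-homo-* x y) (∣ᵘ-* (toℚᵘ-∣ x∣) (toℚᵘ-∣ y∣))

  ∣-neg : ∀ {k x} → p^ k ∣ x → p^ k ∣ - x
  ∣-neg {x = x} x∣ = ≃ᵘ-∣ (ℚₚ.toℚᵘ-homo‿- x) (∣ᵘ-neg (toℚᵘ-∣ x∣))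

  ∣-- : ∀ {k x y} → p^ k ∣ x → p^ k ∣ y → p^ k ∣ x - y
  ∣-- x∣ y∣ = ∣-+ x∣ (∣-neg y∣)

  ∣-cong : ∀ {k x y} → x ≡ y → p^ k ∣ x → p^ k ∣ y
  ∣-cong refl x∣ = x∣

  ∣-cast : ∀ {j k x} → j ≡ k → p^ j ∣ x → p^ k ∣ x
  ∣-cast refl x∣ = x∣

  ∣-weaken : ∀ {j k x} → j ≤ k → p^ k ∣ x → p^ j ∣ x
  ∣-weaken {j} {k} j≤k (num∣∧den∤ num den) = num∣∧den∤ (∣-trans p^j∣p^k num) den
    where
    p^j∣p^k : p ℕ.^ j ∣ p ℕ.^ k
    p^j∣p^k = divides (p ℕ.^ (k ∸ j)) (begin
      p ℕ.^ k                         ≡⟨ cong (p ℕ.^_) (sym (ℕₚ.m+[n∸m]≡n j≤k)) ⟩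
      p ℕ.^ (j ℕ.+ (k ∸ j))           ≡⟨ ℕₚ.^-distribˡ-+-* p j (k ∸ j) ⟩
      p ℕ.^ j ℕ.* p ℕ.^ (k ∸ j)       ≡⟨ ℕₚ.*-comm (p ℕ.^ j) _ ⟩
      p ℕ.^ (k ∸ j) ℕ.* p ℕ.^ j       ∎)

  ∣-0 : ∀ k → p^ k ∣ 0ℚ
  ∣-0 k = num∣∧den∤ (_ ∣0) p∤1

  ∣-1 : p^ 0 ∣ 1ℚ
  ∣-1 = num∣∧den∤ (1∣ _) p∤1

  ∣-ℕ→ℚ : ∀ n → p^ 0 ∣ ℕ→ℚ n
  ∣-ℕ→ℚ n = ∣-cong (sym (ℕ→ℚ≡mkℚ n)) (num∣∧den∤ (1∣ _) p∤1)

  ∣-p : p^ 1 ∣ ℕ→ℚ p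
  ∣-p = ∣-cong (sym (ℕ→ℚ≡mkℚ p)) (num∣∧den∤ (subst (_∣ p) (sym (ℕₚ.*-identityʳ p)) ∣-refl) p∤1)

  ∣-1/[1+] : ∀ {k} → suc k < p → p^ 0 ∣ 1/[1+ k ]
  ∣-1/[1+] {k} k<p = ∣-cong (sym (ℚₚ.normalize-coprime {1} {k} (Coprime.1-coprimeTo (suc k))))
                             (num∣∧den∤ (1∣ _) (p∤-positive (s≤s z≤n) k<p))

  ∣-1/ : ∀ {x} .{{_ : ℚ.NonZero x}} → p^ 0 ∣ x → ¬ p^ 1 ∣ x → p^ 0 ∣ 1/ x
  ∣-1/ {mkℚ ℤ.+[1+ n ] _ _} (num∣∧den∤ _ den) p∤x =
    num∣∧den∤ (1∣ _) λ p∣n → p∤x (num∣∧den∤ (subst (_∣ suc n) (sym (ℕₚ.*-identityʳ p)) p∣n) den)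
  ∣-1/ {mkℚ ℤ.-[1+ n ] _ _} (num∣∧den∤ _ den) p∤x =
    num∣∧den∤ (1∣ _) λ p∣n → p∤x (num∣∧den∤ (subst (_∣ suc n) (sym (ℕₚ.*-identityʳ p)) p∣n) den)

  ∣-sumTo : ∀ {k} n {f : ℕ → ℚ} → (∀ i → i < n → p^ k ∣ f i) → p^ k ∣ sumTo n f
  ∣-sumTo {k} zero    _  = ∣-0 k
  ∣-sumTo     (suc n) f∣ = ∣-+ (∣-sumTo n λ i i<n → f∣ i (ℕₚ.m<n⇒m<1+n i<n)) (f∣ n ℕₚ.≤-refl)

  ∣-H : ∀ {r} → r < p → p^ 0 ∣ H r
  ∣-H {r} r<p = ∣-sumTo r λ i i<r → ∣-1/[1+] (ℕₚ.≤-<-trans i<r r<p)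

  ∣-pow : ∀ {k x} m → p^ k ∣ x → p^ (k ℕ.* m) ∣ pow x m
  ∣-pow {k} zero    _  = ∣-cast (sym (ℕₚ.*-zeroʳ k)) ∣-1
  ∣-pow {k} (suc m) x∣ = ∣-cast (trans (ℕₚ.+-comm (k ℕ.* m) k) (sym (ℕₚ.*-suc k m))) (∣-* (∣-pow m x∣) x∣)

  integral-from-congruent : ∀ {k x y} → p^ k ∣ x - y → p^ 0 ∣ y → p^ 0 ∣ x
  integral-from-congruent {x = x} {y} x≈y y∣ = ∣-cong (cancel x y) (∣-+ (∣-weaken z≤n x≈y) y∣)
    where
    cancel : ∀ x y → (x - y) + y ≡ x
    cancel = solve-∀ ℚ-ring

  congruent-trans : ∀ {k x y z} → p^ k ∣ x - y → p^ k ∣ y - z → p^ k ∣ x - z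
  congruent-trans {x = x} {y} {z} x≈y y≈z = ∣-cong (cancel x y z) (∣-+ x≈y y≈z)
    where
    cancel : ∀ x y z → (x - y) + (y - z) ≡ x - z
    cancel = solve-∀ ℚ-ring

  pow-congruent : ∀ {k x y} m → p^ 0 ∣ x → p^ 0 ∣ y → p^ k ∣ x - y → p^ k ∣ pow x m - pow y m
  pow-congruent {k} zero    _  _  _   = ∣-cong (sym (ℚₚ.+-inverseʳ 1ℚ)) (∣-0 k)
  pow-congruent {k} {x} {y} (suc m) x∣ y∣ x≈y =
    ∣-cong (sym (expand (pow x m) (pow y m) x y))
      (∣-+ (∣-* (∣-pow m x∣) x≈y) (∣-cast (ℕₚ.+-identityʳ k) (∣-* (pow-congruent m x∣ y∣ x≈y) y∣)))
    where
    expand : ∀ X Y x y → X * x - Y * y ≡ X * (x - y) + (X - Y) * y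
    expand = solve-∀ ℚ-ring

  prodTo-1+-congruent : ∀ n {z : ℕ → ℚ} → (∀ i → i < n → p^ 1 ∣ z i) →
    p^ 2 ∣ prodTo n (λ i → 1ℚ + z i) - (1ℚ + sumTo n z)
  prodTo-1+-congruent zero    _  = ∣-cong (sym (ℚₚ.+-inverseʳ 1ℚ)) (∣-0 2)
  prodTo-1+-congruent (suc n) {z} z∣ =
    ∣-cong (sym (expand (prodTo n (λ i → 1ℚ + z i)) (sumTo n z) (z n)))
      (∣-+ (∣-* (prodTo-1+-congruent n z∣′) (∣-+ ∣-1 (∣-weaken z≤n (z∣ n ℕₚ.≤-refl))))
           (∣-* (∣-sumTo n z∣′) (z∣ n ℕₚ.≤-refl)))
    where
    z∣′ : ∀ i → i < n → p^ 1 ∣ z i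
    z∣′ i i<n = z∣ i (ℕₚ.m<n⇒m<1+n i<n)
    expand : ∀ P S z → P * (1ℚ + z) - (1ℚ + (S + z)) ≡ (P - (1ℚ + S)) * (1ℚ + z) + S * z
    expand = solve-∀ ℚ-ring

  pow-1+-congruent : ∀ {z} m → p^ 1 ∣ z → p^ 2 ∣ pow (1ℚ + z) m - (1ℚ + ℕ→ℚ m * z)
  pow-1+-congruent {z} m z∣ =
    ∣-cong (cong₂ (λ x y → x - (1ℚ + y)) (sym (pow≡prodTo (1ℚ + z) m)) (sumTo-const m z))
      (prodTo-1+-congruent m (λ _ _ → z∣))

  pow-congruent-1+ : ∀ {P z} m → p^ 1 ∣ z → p^ 2 ∣ P - (1ℚ + z) → p^ 2 ∣ pow P m - (1ℚ + ℕ→ℚ m * z)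
  pow-congruent-1+ {P} {z} m z∣ P≈ =
    congruent-trans {x = pow P m} {pow (1ℚ + z) m}
      (pow-congruent {x = P} {1ℚ + z} m (integral-from-congruent {x = P} P≈ 1+z∣) 1+z∣ P≈)
      (pow-1+-congruent m z∣)
    where
    1+z∣ : p^ 0 ∣ 1ℚ + z
    1+z∣ = ∣-+ ∣-1 (∣-weaken z≤n z∣)

  *-1+-congruent : ∀ {X Y x y} → p^ 1 ∣ x → p^ 1 ∣ y →
    p^ 2 ∣ X - (1ℚ + x) → p^ 2 ∣ Y - (1ℚ + y) → p^ 2 ∣ X * Y - (1ℚ + (x + y))
  *-1+-congruent {X} {Y} {x} {y} x∣ y∣ X≈ Y≈ =
    ∣-cong (sym (expand X Y x y))
      (∣-+ (∣-+ (∣-* X≈ Y∣) (∣-* (∣-+ ∣-1 (∣-weaken z≤n x∣)) Y≈)) (∣-* x∣ y∣))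
    where
    Y∣ : p^ 0 ∣ Y
    Y∣ = integral-from-congruent Y≈ (∣-+ ∣-1 (∣-weaken z≤n y∣))
    expand : ∀ X Y x y → X * Y - (1ℚ + (x + y)) ≡ ((X - (1ℚ + x)) * Y + (1ℚ + x) * (Y - (1ℚ + y))) + x * y
    expand = solve-∀ ℚ-ring

  -- 1/i + 1/(p - i) = p/(i(p - i)).
  p^1∣H[p-1] : ∀ {N} → 2 < p → p ≡ suc N → p^ 1 ∣ H N
  p^1∣H[p-1] {N} 2<p p≡1+N = ∣-cong (half-double (H N)) (∣-* (∣-1/[1+] 2<p) 2H∣)
    where
    half-double : ∀ x → ½ * (x + x) ≡ x
    half-double = solve-∀ ℚ-ring
    complement : ∀ {i} → i < N → suc i ℕ.+ suc (N ∸ suc i) ≡ p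
    complement {i} i<N = begin
      suc i ℕ.+ suc (N ∸ suc i)   ≡⟨ cong (suc i ℕ.+_) (sym (n∸i≡1+[n∸1+i] i<N)) ⟩
      suc i ℕ.+ (N ∸ i)           ≡⟨ cong suc (ℕₚ.m+[n∸m]≡n (ℕₚ.<⇒≤ i<N)) ⟩
      suc N                       ≡⟨ sym p≡1+N ⟩
      p                           ∎
    below-p : ∀ {j} → j < N → suc j < p
    below-p j<N = subst (_ <_) (sym p≡1+N) (s≤s j<N)
    pair : ∀ {i} → i < N → 1/[1+ i ] + 1/[1+ N ∸ suc i ] ≡ ℕ→ℚ p * (1/[1+ i ] * 1/[1+ N ∸ suc i ])
    pair {i} i<N = sym (begin
      ℕ→ℚ p * (v * w)                                   ≡⟨ cong (λ n → ℕ→ℚ n * (v * w)) (sym (complement i<N)) ⟩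
      ℕ→ℚ (suc i ℕ.+ suc j) * (v * w)                   ≡⟨ cong (_* (v * w)) (ℕ→ℚ-+ (suc i) (suc j)) ⟩
      (ℕ→ℚ (suc i) + ℕ→ℚ (suc j)) * (v * w)             ≡⟨ spread (ℕ→ℚ (suc i)) (ℕ→ℚ (suc j)) v w ⟩
      (ℕ→ℚ (suc i) * v) * w + (ℕ→ℚ (suc j) * w) * v     ≡⟨ cong₂ (λ x y → x * w + y * v) (ℕ→ℚ-*-1/[1+] i) (ℕ→ℚ-*-1/[1+] j) ⟩
      1ℚ * w + 1ℚ * v                                   ≡⟨ unit v w ⟩
      v + w                                             ∎)
      where
      j : ℕ
      j = N ∸ suc i
      v w : ℚ
      v = 1/[1+ i ]
      w = 1/[1+ j ]
      spread : ∀ a b v w → (a + b) * (v * w) ≡ (a * v) * w + (b * w) * v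
      spread = solve-∀ ℚ-ring
      unit : ∀ v w → 1ℚ * w + 1ℚ * v ≡ v + w
      unit = solve-∀ ℚ-ring
    2H∣ : p^ 1 ∣ H N + H N
    2H∣ = ∣-cong (sym paired) (∣-sumTo N λ i i<N →
      ∣-* ∣-p (∣-* (∣-1/[1+] (below-p i<N)) (∣-1/[1+] (below-p (subst (_≤ N) (n∸i≡1+[n∸1+i] i<N) (ℕₚ.m∸n≤m N i))))))
      where
      paired : H N + H N ≡ sumTo N (λ i → ℕ→ℚ p * (1/[1+ i ] * 1/[1+ N ∸ suc i ]))
      paired = begin
        H N + H N                                           ≡⟨ cong (H N +_) (sumTo-reverse N 1/[1+_]) ⟩
        H N + sumTo N (λ i → 1/[1+ N ∸ suc i ])             ≡⟨ sym (sumTo-+ N 1/[1+_] (λ i → 1/[1+ N ∸ suc i ])) ⟩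
        sumTo N (λ i → 1/[1+ i ] + 1/[1+ N ∸ suc i ])       ≡⟨ sumTo-cong N (λ i i<N → pair i<N) ⟩
        sumTo N (λ i → ℕ→ℚ p * (1/[1+ i ] * 1/[1+ N ∸ suc i ])) ∎

  binomQ[x+k,k]-congruent : ∀ {x} k → p^ 1 ∣ x → k < p → p^ 2 ∣ binomQ (x + ℕ→ℚ k) k - (1ℚ + x * H k)
  binomQ[x+k,k]-congruent {x} k x∣ k<p = ∣-cong (cong₂ (λ B S → B - (1ℚ + S)) (sym B≡) (sumTo-*ˡ k x 1/[1+_]))
    (prodTo-1+-congruent k λ j j<k → ∣-* x∣ (∣-1/[1+] (ℕₚ.≤-<-trans j<k k<p)))
    where
    c≡x : x + ℕ→ℚ k - ℕ→ℚ (0 ℕ.+ k ℕ.+ 0) ≡ x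
    c≡x = trans (cong (λ n → x + ℕ→ℚ k - ℕ→ℚ n) (ℕₚ.+-identityʳ k)) (cancel x (ℕ→ℚ k))
      where
      cancel : ∀ x k → x + k - k ≡ x
      cancel = solve-∀ ℚ-ring
    B≡ : binomQ (x + ℕ→ℚ k) k ≡ prodTo k (λ j → 1ℚ + x * 1/[1+ j ])
    B≡ = begin
      binomQ (x + ℕ→ℚ k) k                                                       ≡⟨ binomQ≡prodTo (x + ℕ→ℚ k) k ⟩
      prodTo k (λ j → (x + ℕ→ℚ k - ℕ→ℚ j) * 1/[1+ j ])                           ≡⟨ prodTo-reflect (x + ℕ→ℚ k) 0 0 k ⟩
      prodTo k (λ j → 1ℚ + (x + ℕ→ℚ k - ℕ→ℚ (0 ℕ.+ k ℕ.+ 0)) * 1/[1+ j ])        ≡⟨ prodTo-cong k (λ j _ → cong (λ y → 1ℚ + y * 1/[1+ j ]) c≡x) ⟩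
      prodTo k (λ j → 1ℚ + x * 1/[1+ j ])                                        ∎

  p*binomQ-factorisation : ∀ {a} r → 2 < p → r < p → p^ 1 ∣ a - ℕ→ℚ r →
    Σ ℚ λ P → binomQ a p * ℕ→ℚ p ≡ (a - ℕ→ℚ r) * P × p^ 2 ∣ P - (1ℚ + ℕ→ℚ p * H r)
  p*binomQ-factorisation {a} r 2<p r<p d∣ =
    B * T , trans (cong (λ k → binomQ a k * ℕ→ℚ k) p≡) (binomQ-*-index a r n) , congruent-trans {x = B * T} BT≈ sum≈
    where
    n : ℕ
    n = proj₁ (ℕₚ.m≤n⇒∃[o]m+o≡n r<p)
    p≡ : p ≡ suc (r ℕ.+ n)
    p≡ = sym (proj₂ (ℕₚ.m≤n⇒∃[o]m+o≡n r<p))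
    d e B T S : ℚ
    d = a - ℕ→ℚ r
    e = a - ℕ→ℚ (suc r ℕ.+ n ℕ.+ r)
    B = binomQ a r
    T = prodTo n (λ s → (a - ℕ→ℚ (suc (r ℕ.+ s))) * 1/[1+ r ℕ.+ s ])
    S = sumTo n (λ s → 1/[1+ r ℕ.+ s ])

    e≡d-p : e ≡ d - ℕ→ℚ p
    e≡d-p = begin
      a - ℕ→ℚ (suc r ℕ.+ n ℕ.+ r)   ≡⟨ cong (λ k → a - ℕ→ℚ (k ℕ.+ r)) (sym p≡) ⟩
      a - ℕ→ℚ (p ℕ.+ r)             ≡⟨ cong (λ x → a - x) (ℕ→ℚ-+ p r) ⟩
      a - (ℕ→ℚ p + ℕ→ℚ r)           ≡⟨ swap a (ℕ→ℚ p) (ℕ→ℚ r) ⟩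
      a - ℕ→ℚ r - ℕ→ℚ p             ∎
      where
      swap : ∀ a q r → a - (q + r) ≡ a - r - q
      swap = solve-∀ ℚ-ring

    e∣ : p^ 1 ∣ e
    e∣ = ∣-cong (sym e≡d-p) (∣-- d∣ ∣-p)
    S∣ : p^ 0 ∣ S
    S∣ = ∣-sumTo n λ s s<n → ∣-1/[1+] (subst (suc (r ℕ.+ s) <_) (sym p≡) (s≤s (ℕₚ.+-monoʳ-< r s<n)))

    B≈ : p^ 2 ∣ B - (1ℚ + d * H r)
    B≈ = ∣-cong (cong (λ y → binomQ y r - (1ℚ + d * H r)) (cancel a (ℕ→ℚ r))) (binomQ[x+k,k]-congruent r d∣ r<p)
      where
      cancel : ∀ a r → a - r + r ≡ a
      cancel = solve-∀ ℚ-ring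
    T≈ : p^ 2 ∣ T - (1ℚ + e * S)
    T≈ = ∣-cong (cong₂ (λ P Σ → P - (1ℚ + Σ)) (sym (prodTo-reflect a (suc r) r n)) (sumTo-*ˡ n e (λ s → 1/[1+ r ℕ.+ s ])))
      (prodTo-1+-congruent n λ s s<n → ∣-* e∣ (∣-1/[1+] (subst (suc (r ℕ.+ s) <_) (sym p≡) (s≤s (ℕₚ.+-monoʳ-< r s<n)))))
    BT≈ : p^ 2 ∣ B * T - (1ℚ + (d * H r + e * S))
    BT≈ = *-1+-congruent {B} {T} {d * H r} {e * S} (∣-* d∣ (∣-H r<p)) (∣-* e∣ S∣) B≈ T≈

    sum≈ : p^ 2 ∣ (1ℚ + (d * H r + e * S)) - (1ℚ + ℕ→ℚ p * H r)
    sum≈ = ∣-cong (sym (begin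
      (1ℚ + (d * H r + e * S)) - (1ℚ + ℕ→ℚ p * H r)             ≡⟨ cong (λ y → (1ℚ + (d * H r + y * S)) - (1ℚ + ℕ→ℚ p * H r)) e≡d-p ⟩
      (1ℚ + (d * H r + (d - ℕ→ℚ p) * S)) - (1ℚ + ℕ→ℚ p * H r)   ≡⟨ collect d (ℕ→ℚ p) (H r) S ⟩
      (d - ℕ→ℚ p) * (H r + S)                                   ≡⟨ cong₂ _*_ (sym e≡d-p) (sym (sumTo-split r n 1/[1+_])) ⟩
      e * H (r ℕ.+ n)                                           ∎))
      (∣-* e∣ (p^1∣H[p-1] 2<p p≡))
      where
      collect : ∀ d q H S → (1ℚ + (d * H + (d - q) * S)) - (1ℚ + q * H) ≡ (d - q) * (H + S)
      collect = solve-∀ ℚ-ring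

  pow-p*binomQ-factorisation : ∀ {a} m r → 2 < p → r < p → p^ 1 ∣ a - ℕ→ℚ r →
    Σ ℚ λ Q → pow (binomQ a p * ℕ→ℚ p) m ≡ pow (a - ℕ→ℚ r) m * Q × p^ 2 ∣ Q - (1ℚ + ℕ→ℚ m * ℕ→ℚ p * H r)
  pow-p*binomQ-factorisation {a} m r 2<p r<p d∣ =
    let P , pB≡dP , P≈ = p*binomQ-factorisation r 2<p r<p d∣ in
    pow P m , trans (cong (λ x → pow x m) pB≡dP) (pow-* (a - ℕ→ℚ r) P m) ,
    ∣-cong (cong (λ c → pow P m - (1ℚ + c)) (sym (ℚₚ.*-assoc (ℕ→ℚ m) (ℕ→ℚ p) (H r))))
           (pow-congruent-1+ m (∣-* ∣-p (∣-H r<p)) P≈)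

difference-factorises : ∀ m′ i d Q c →
  ½ * pow (ℕ→ℚ 2 * i) (suc m′) * (pow d (suc m′) * Q) - pow (ℕ→ℚ 2) m′ * pow (d * i) (suc m′) * (1ℚ + c) ≡
  pow (ℕ→ℚ 2) m′ * pow i (suc m′) * pow d (suc m′) * (Q - (1ℚ + c))
difference-factorises m′ i d Q c = begin
  ½ * pow (ℕ→ℚ 2 * i) m * (pow d m * Q) - pow (ℕ→ℚ 2) m′ * pow (d * i) m * (1ℚ + c)
    ≡⟨ cong₂ (λ x y → ½ * x * (pow d m * Q) - pow (ℕ→ℚ 2) m′ * y * (1ℚ + c)) (pow-* (ℕ→ℚ 2) i m) (pow-* d i m) ⟩
  ½ * (pow (ℕ→ℚ 2) m′ * ℕ→ℚ 2 * pow i m) * (pow d m * Q) - pow (ℕ→ℚ 2) m′ * (pow d m * pow i m) * (1ℚ + c)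
    ≡⟨ collect (pow (ℕ→ℚ 2) m′) (pow i m) (pow d m) Q c ⟩
  pow (ℕ→ℚ 2) m′ * pow i m * pow d m * (Q - (1ℚ + c)) ∎
  where
  m : ℕ
  m = suc m′
  collect : ∀ T I D Q c → ½ * (T * ℕ→ℚ 2 * I) * (D * Q) - T * (D * I) * (1ℚ + c) ≡ T * I * D * (Q - (1ℚ + c))
  collect = solve-∀ ℚ-ring

theorem2p1 : (m : ℕ) → 1 ≤ m → (p : ℕ) → Prime p → p ≢ 2 →
    (a : ℚ) → InZp p a → ¬ CongQ p 1 a 0ℚ → .{{_ : NonZero a}} →
    (r : ℕ) → r < p → CongQ p 1 a (ℕ→ℚ r) →
    CongQ p (m ℕ.+ 2)
      (sumTo p (λ k → pow (binomQ a k) m *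
        sumTo (suc ((m ∸ 1) ℕ./ 2)) (λ j →
          ℕ→ℚ (m C (2 ℕ.* j ℕ.+ 1)) * pow (1ℚ - ℕ→ℚ 2 * (1/ a) * ℕ→ℚ k) (2 ℕ.* j ℕ.+ 1))))
      (sumTo p (λ k → pow (- 1ℚ) k * pow (binomQ a k) m *
        sumTo (suc (m ℕ./ 2)) (λ j →
          ℕ→ℚ (m C (2 ℕ.* j)) * pow (1ℚ - ℕ→ℚ 2 * (1/ a) * ℕ→ℚ k) (2 ℕ.* j))))
    ×
    CongQ p (m ℕ.+ 2)
      (sumTo p (λ k → pow (- 1ℚ) k * pow (binomQ a k) m *
        sumTo (suc (m ℕ./ 2)) (λ j →
          ℕ→ℚ (m C (2 ℕ.* j)) * pow (1ℚ - ℕ→ℚ 2 * (1/ a) * ℕ→ℚ k) (2 ℕ.* j))))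
      (pow (ℕ→ℚ 2) (m ∸ 1) * pow ((a - ℕ→ℚ r) * (1/ a)) m *
        (1ℚ + ℕ→ℚ m * ℕ→ℚ p * H r))
theorem2p1 (suc m′) _ p p-prime p≢2 a a∈ℤₚ a≢0 r r<p a≡r =
  toCongQ {x = oddSideSum p} sums-equal ,
  toCongQ {x = evenSideSum p} (evenSide-congruent (pow-p*binomQ-factorisation m r 2<p r<p d∣))
  where
  open PAdic p-prime
  open Telescoping a (suc m′)
  m : ℕ
  m = suc m′
  d c R : ℚ
  d = a - ℕ→ℚ r
  c = ℕ→ℚ m * ℕ→ℚ p * H r
  R = pow (ℕ→ℚ 2) m′ * pow (d * 1/ a) m * (1ℚ + c)
  d∣ : p^ 1 ∣ d
  d∣ = fromCongQ {x = a} {ℕ→ℚ r} a≡r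
  2<p : 2 < p
  2<p = ℕₚ.≤∧≢⇒< (ℕ.nonTrivial⇒n>1 p) (p≢2 ∘ sym)
  a-unit : ¬ p^ 1 ∣ a
  a-unit p∣a = a≢0 (toCongQ {x = a} {0ℚ} (∣-cong (sym (ℚₚ.+-identityʳ a)) p∣a))
  evenSide≡ : evenSideSum p ≡ ½ * pow u m * g p
  evenSide≡ = evenSideSum-closed (proj₁ (prime⇒odd p-prime p≢2)) (proj₂ (prime⇒odd p-prime p≢2))

  sums-equal : p^ (m ℕ.+ 2) ∣ oddSideSum p - evenSideSum p
  sums-equal = ∣-cong (sym (trans (cong₂ _-_ (oddSideSum-closed p) evenSide≡) (ℚₚ.+-inverseʳ (½ * pow u m * g p)))) (∣-0 _)

  evenSide-congruent : (Σ ℚ λ Q → g p ≡ pow d m * Q × p^ 2 ∣ Q - (1ℚ + c)) → p^ (m ℕ.+ 2) ∣ evenSideSum p - R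
  evenSide-congruent (Q , gp≡dᵐQ , Q≈) =
    ∣-cong (sym (trans (cong (_- R) (trans evenSide≡ (cong (½ * pow u m *_) gp≡dᵐQ))) (difference-factorises m′ (1/ a) d Q c)))
      (∣-* (∣-* (∣-* (∣-pow m′ (∣-ℕ→ℚ 2)) (∣-pow {k = 0} m (∣-1/ (num∣∧den∤ (1∣ _) a∈ℤₚ) a-unit)))
                (∣-cast (ℕₚ.*-identityˡ m) (∣-pow m d∣)))
           Q≈)
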